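{- Let $G$ be a graph of order $n\geq 4$. Then (1) $\mu_{n-1}(G)=1$ if and only if $G$ is a complete graph; (2) $\mu_{n-1}(G)=0$ if and only if $G$ is not a complete graph.
   Context: For a graph $G$ and $S\subseteq V(G)$ with $|S|\geq 2$, a pendant $S$-Steiner tree is a subgraph of $G$ that is a tree whose vertex set contains $S$ and in which every vertex of $S$ has degree exactly $1$. $\mu_G(S)$ is the maximum number of pairwise edge-disjoint pendant $S$-Steiner trees in $G$, and for $2\leq k\leq |V(G)|$, $\mu_k(G)=\min\{\mu_G(S): S\subseteq V(G),|S|=k\}$. -}

module Defs where

open import Data.Nat using (ℕ; zero; suc; _≤_; _∸_)
open import Data.Bool using (Bool; true; false)
open import Data.Fin using (Fin)
open import Data.Fin.Subset using (Subset; _∈_; _⊆_; ∣_∣)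
open import Data.List using (List; []; _∷_; length; filterᵇ; _∷ʳ_)
open import Data.List.Relation.Unary.Unique.Propositional using (Unique)
open import Data.Vec using (Vec; lookup)
open import Data.Product using (Σ; _×_; ∃)
open import Relation.Binary.PropositionalEquality using (_≡_; _≢_)
open import Relation.Nullary using (¬_)
import Data.List as L

record Graph (n : ℕ) : Set where
  field
    adj     : Fin n → Fin n → Bool
    adj-sym : ∀ u v → adj u v ≡ adj v u
    adj-irr : ∀ v → adj v v ≡ false
open Graph public

Complete : ∀ {n} → Graph n → Set
Complete {n} G = ∀ (u v : Fin n) → u ≢ v → adj G u v ≡ true

record Subgraph {n : ℕ} (G : Graph n) : Set where
  field
    vert     : Subset n
    edge     : Fin n → Fin n → Bool
    edge-sym : ∀ u v → edge u v ≡ edge v u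
    edge-adj : ∀ u v → edge u v ≡ true → adj G u v ≡ true
    edge-vert : ∀ u v → edge u v ≡ true → u ∈ vert
open Subgraph public

module _ {n : ℕ} {G : Graph n} (H : Subgraph G) where

  degree : Fin n → ℕ
  degree v = length (filterᵇ (edge H v) (L.allFin n))

  data Walk : Fin n → Fin n → Set where
    here : ∀ {u} → Walk u u
    step : ∀ {u w v} → edge H u w ≡ true → Walk w v → Walk u v

  Connected : Set
  Connected = ∀ u v → u ∈ vert H → v ∈ vert H → Walk u v

  Chain : List (Fin n) → Set
  Chain []            = Data.Unit.⊤ where import Data.Unit
  Chain (x ∷ [])      = Data.Unit.⊤ where import Data.Unit
  Chain (x ∷ y ∷ xs)  = (edge H x y ≡ true) × Chain (y ∷ xs)

  HasCycle : Set
  HasCycle = Σ (Fin n) λ v → Σ (List (Fin n)) λ vs →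
    (2 ≤ length vs) × Unique (v ∷ vs) × Chain ((v ∷ vs) ∷ʳ v)

  Acyclic : Set
  Acyclic = ¬ HasCycle

  IsTree : Set
  IsTree = Connected × Acyclic

  IsPendantSteinerTree : Subset n → Set
  IsPendantSteinerTree S = IsTree × (S ⊆ vert H) × (∀ v → v ∈ S → degree v ≡ 1)

EdgeDisjoint : ∀ {n} {G : Graph n} → Subgraph G → Subgraph G → Set
EdgeDisjoint {n} H K = ∀ (u v : Fin n) → edge H u v ≡ true → edge K u v ≡ false

Packing : ∀ {n} → Graph n → Subset n → ℕ → Set
Packing {n} G S m = Σ (Vec (Subgraph G) m) λ T →
  (∀ i → IsPendantSteinerTree (lookup T i) S) ×
  (∀ i j → i ≢ j → EdgeDisjoint (lookup T i) (lookup T j))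

-- μ_G(S) = m : m is the maximum size of such a packing
IsMuS : ∀ {n} → Graph n → Subset n → ℕ → Set
IsMuS G S m = Packing G S m × (∀ m' → Packing G S m' → m' ≤ m)

-- μ_k(G) = m : m is the minimum of μ_G(S) over all S with |S| = k
IsMuK : ∀ {n} → Graph n → ℕ → ℕ → Set
IsMuK {n} G k m =
  (Σ (Subset n) λ S → (∣ S ∣ ≡ k) × IsMuS G S m) ×
  (∀ (S : Subset n) → ∣ S ∣ ≡ k → ∀ m' → IsMuS G S m' → m ≤ m')

-- Let S = V ∖ {x}. Every vertex s of S is a leaf of a pendant S-Steiner tree, and its
-- neighbour is not in S: otherwise s and that neighbour would be a component on their own,
-- missing a third vertex of S (this is where n ≥ 4 enters). So every such tree contains all
-- the edges s x. Hence two trees always share an edge (μ_G(S) ≤ 1), a non-edge s x leaves no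
-- tree at all (μ_G(S) = 0), and in a complete graph the star centred at x is a tree
-- (μ_G(S) = 1). As every (n−1)-set is of the form V ∖ {x}, μ_{n−1}(G) is 1 if G is complete
-- and 0 otherwise.
module Submission where

open import Defs
open import Data.Nat using (ℕ; zero; suc; _≤_; _<_; _∸_; z≤n; s≤s)
open import Data.Nat.Properties using (≤-reflexive; ≤-refl; ≤-trans; ≤-antisym; n≤1+n; suc-injective; m+n∸n≡m)
open import Data.Fin using (Fin; zero; suc; _≟_)
open import Data.Fin.Properties using (any?)
open import Data.Fin.Subset using (Subset; inside; outside; ⊤; _∈_; _∉_; ∣_∣; ∁; ⁅_⁆; _-_; Nonempty)
  renaming (⊥ to ∅)
open import Data.Fin.Subset.Properties
  using ( ∣∁p∣≡n∸∣p∣; ∣⁅x⁆∣≡1; p─⊥≡p; p─q⊆p; x∈∁p⇒x∉p; x∉p⇒x∈∁p; x∉∁p⇒x∈p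
        ; x≢y⇒x∉⁅y⁆; x∉⁅y⁆⇒x≢y; x∈⁅y⁆⇒x≡y; ∈⊤)
open import Data.Vec using ([]; _∷_; here; there)
open import Data.Bool using (Bool; true; false; _xor_; T?)
import Data.Bool as Bool
open import Data.Bool.Properties using (not-involutive; xor-same; T-≡; ¬-not)
open import Data.List using (List; []; _∷_; length; filterᵇ; allFin; _∷ʳ_)
open import Data.List.Relation.Unary.Any using (here; there)
open import Data.List.Relation.Unary.Any.Properties using (singleton⁻)
open import Data.List.Relation.Unary.All using (All; _∷_)
open import Data.List.Relation.Unary.AllPairs using (_∷_)
open import Data.List.Relation.Unary.Unique.Propositional using (Unique)
open import Data.List.Relation.Unary.Unique.Propositional.Properties using (allFin⁺; filter⁺)
import Data.List.Membership.Propositional as List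
open import Data.List.Membership.Propositional.Properties using (∈-filter⁺; ∈-filter⁻; ∈-allFin)
open import Data.Product using (∃; ∃₂; _×_; _,_; proj₁; proj₂)
open import Data.Sum using (_⊎_; inj₁; inj₂; [_,_]′)
open import Function.Base using (_∘_; id)
open import Function.Bundles using (_⇔_; mk⇔; Equivalence)
open import Relation.Binary.PropositionalEquality using (_≡_; _≢_; refl; sym; trans; cong; cong₂; subst)
open import Relation.Nullary using (¬_; yes; no; does; ¬?; contradiction)
open import Relation.Nullary.Decidable using (dec-true; dec-false; _×-dec_)

private
  variable
    n : ℕ

0<∣p∣⇒nonempty : ∀ {p : Subset n} → 0 < ∣ p ∣ → Nonempty p
0<∣p∣⇒nonempty {p = inside  ∷ p} _ = zero , here
0<∣p∣⇒nonempty {p = outside ∷ p} h with 0<∣p∣⇒nonempty h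
... | x , x∈p = suc x , there x∈p

∣p∣≡0⇒p≡∅ : ∀ {p : Subset n} → ∣ p ∣ ≡ 0 → p ≡ ∅
∣p∣≡0⇒p≡∅ {p = []}          _ = refl
∣p∣≡0⇒p≡∅ {p = outside ∷ p} h = cong (outside ∷_) (∣p∣≡0⇒p≡∅ h)

∣p∣≡1⇒p≡⁅x⁆ : ∀ {p : Subset n} → ∣ p ∣ ≡ 1 → ∃ λ x → p ≡ ⁅ x ⁆
∣p∣≡1⇒p≡⁅x⁆ {p = inside  ∷ p} h = zero , cong (inside ∷_) (∣p∣≡0⇒p≡∅ (suc-injective h))
∣p∣≡1⇒p≡⁅x⁆ {p = outside ∷ p} h with ∣p∣≡1⇒p≡⁅x⁆ h
... | x , p≡⁅x⁆ = suc x , cong (outside ∷_) p≡⁅x⁆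

∁-involutive : ∀ (p : Subset n) → ∁ (∁ p) ≡ p
∁-involutive []      = refl
∁-involutive (s ∷ p) = cong₂ _∷_ (not-involutive s) (∁-involutive p)

∣p∣≤1+∣p-x∣ : ∀ (p : Subset n) x → ∣ p ∣ ≤ suc ∣ p - x ∣
∣p∣≤1+∣p-x∣ (inside  ∷ p) zero    = subst (λ q → suc ∣ p ∣ ≤ suc ∣ q ∣) (sym (p─⊥≡p p)) ≤-refl
∣p∣≤1+∣p-x∣ (outside ∷ p) zero    = subst (λ q → ∣ p ∣ ≤ suc ∣ q ∣) (sym (p─⊥≡p p)) (n≤1+n _)
∣p∣≤1+∣p-x∣ (inside  ∷ p) (suc x) = s≤s (∣p∣≤1+∣p-x∣ p x)
∣p∣≤1+∣p-x∣ (outside ∷ p) (suc x) = ∣p∣≤1+∣p-x∣ p x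

x∉p-x : ∀ (p : Subset n) x → x ∉ p - x
x∉p-x (_ ∷ p) (suc x) (there x∈p-x) = x∉p-x p x x∈p-x

x∈p-y⇒x≢y : ∀ {p : Subset n} {x y} → x ∈ p - y → x ≢ y
x∈p-y⇒x≢y {p = p} x∈p-x refl = x∉p-x p _ x∈p-x

x∈p-y⇒x∈p : ∀ {p : Subset n} {x y} → x ∈ p - y → x ∈ p
x∈p-y⇒x∈p {p = p} {y = y} = p─q⊆p p ⁅ y ⁆

∈-avoiding₂ : ∀ {p : Subset n} → 2 < ∣ p ∣ → ∀ a b → ∃ λ t → t ∈ p × t ≢ a × t ≢ b
∈-avoiding₂ {p = p} 2<∣p∣ a b with 0<∣p∣⇒nonempty {p = p - a - b} 0<∣p-a-b∣
  where
  0<∣p-a-b∣ : 0 < ∣ p - a - b ∣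
  0<∣p-a-b∣ with ≤-trans 2<∣p∣ (≤-trans (∣p∣≤1+∣p-x∣ p a) (s≤s (∣p∣≤1+∣p-x∣ (p - a) b)))
  ... | s≤s (s≤s h) = h
... | t , t∈p-a-b =
  t , x∈p-y⇒x∈p (x∈p-y⇒x∈p t∈p-a-b) , x∈p-y⇒x≢y (x∈p-y⇒x∈p t∈p-a-b) , x∈p-y⇒x≢y t∈p-a-b

x∈∁⁅y⁆⇔x≢y : ∀ {x y : Fin n} → x ∈ ∁ ⁅ y ⁆ ⇔ x ≢ y
x∈∁⁅y⁆⇔x≢y = mk⇔ (λ x∈ → x∉⁅y⁆⇒x≢y (x∈∁p⇒x∉p x∈)) (λ x≢y → x∉p⇒x∈∁p (x≢y⇒x∉⁅y⁆ x≢y))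

∣∁⁅x⁆∣≡m : ∀ {m} (x : Fin (suc m)) → ∣ ∁ ⁅ x ⁆ ∣ ≡ m
∣∁⁅x⁆∣≡m {m} x = trans (∣∁p∣≡n∸∣p∣ ⁅ x ⁆) (cong (suc m ∸_) (∣⁅x⁆∣≡1 x))

∣p∣≡m⇒p≡∁⁅x⁆ : ∀ {m} {p : Subset (suc m)} → ∣ p ∣ ≡ m → ∃ λ x → p ≡ ∁ ⁅ x ⁆
∣p∣≡m⇒p≡∁⁅x⁆ {m} {p} ∣p∣≡m with ∣p∣≡1⇒p≡⁅x⁆ ∣∁p∣≡1
  where
  ∣∁p∣≡1 : ∣ ∁ p ∣ ≡ 1
  ∣∁p∣≡1 = trans (∣∁p∣≡n∸∣p∣ p) (trans (cong (suc m ∸_) ∣p∣≡m) (m+n∸n≡m 1 m))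
... | x , ∁p≡⁅x⁆ = x , trans (sym (∁-involutive p)) (cong ∁ ∁p≡⁅x⁆)

length≡1⇒∈-unique : ∀ {A : Set} {xs : List A} → length xs ≡ 1 →
  ∃ λ x → x List.∈ xs × (∀ {y} → y List.∈ xs → y ≡ x)
length≡1⇒∈-unique {xs = x ∷ []} refl = x , here refl , singleton⁻

∈-unique⇒length≡1 : ∀ {A : Set} {xs : List A} {x} → Unique xs → x List.∈ xs →
  (∀ {y} → y List.∈ xs → y ≡ x) → length xs ≡ 1
∈-unique⇒length≡1 {xs = _ ∷ []}    _               _ _  = refl
∈-unique⇒length≡1 {xs = _ ∷ _ ∷ _} ((y≢z ∷ _) ∷ _) _ ≡x =
  contradiction (trans (≡x (here refl)) (sym (≡x (there (here refl))))) y≢z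

_◅◅_ : ∀ {G : Graph n} {H : Subgraph G} {u v w} → Walk H u v → Walk H v w → Walk H u w
here     ◅◅ q = q
step e p ◅◅ q = step e (p ◅◅ q)

module _ {G : Graph n} (H : Subgraph G) where

  neighbours : Fin n → List (Fin n)
  neighbours v = filterᵇ (edge H v) (allFin n)

  ∈-neighbours⁺ : ∀ {v w} → edge H v w ≡ true → w List.∈ neighbours v
  ∈-neighbours⁺ {v} v~w = ∈-filter⁺ (T? ∘ edge H v) (∈-allFin _) (Equivalence.from T-≡ v~w)

  ∈-neighbours⁻ : ∀ {v w} → w List.∈ neighbours v → edge H v w ≡ true
  ∈-neighbours⁻ {v} w∈ = Equivalence.to T-≡ (proj₂ (∈-filter⁻ (T? ∘ edge H v) {xs = allFin n} w∈))

  OnlyNeighbour : Fin n → Fin n → Set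
  OnlyNeighbour v w = edge H v w ≡ true × (∀ {u} → edge H v u ≡ true → u ≡ w)

  degree≡1⇒neighbour : ∀ {v} → degree H v ≡ 1 → ∃ λ w → edge H v w ≡ true
  degree≡1⇒neighbour deg≡1 with w , w∈ , _ ← length≡1⇒∈-unique deg≡1 =
    w , ∈-neighbours⁻ w∈

  degree≡1⇒onlyNeighbour : ∀ {v w} → degree H v ≡ 1 → edge H v w ≡ true → OnlyNeighbour v w
  degree≡1⇒onlyNeighbour deg≡1 v~w with _ , _ , ≡x ← length≡1⇒∈-unique deg≡1 =
    v~w , λ v~u → trans (≡x (∈-neighbours⁺ v~u)) (sym (≡x (∈-neighbours⁺ v~w)))

  onlyNeighbour⇒degree≡1 : ∀ {v w} → OnlyNeighbour v w → degree H v ≡ 1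
  onlyNeighbour⇒degree≡1 {v} (v~w , only) =
    ∈-unique⇒length≡1 (filter⁺ (T? ∘ edge H v) (allFin⁺ n)) (∈-neighbours⁺ v~w) (only ∘ ∈-neighbours⁻)

  walk-from-pendant-edge : ∀ {s c u t} → OnlyNeighbour s c → OnlyNeighbour c s →
    u ≡ s ⊎ u ≡ c → Walk H u t → t ≡ s ⊎ t ≡ c
  walk-from-pendant-edge _   _   u∈ here = u∈
  walk-from-pendant-edge s~c c~s (inj₁ refl) (step e w) =
    walk-from-pendant-edge s~c c~s (inj₂ (proj₂ s~c e)) w
  walk-from-pendant-edge s~c c~s (inj₂ refl) (step e w) =
    walk-from-pendant-edge s~c c~s (inj₁ (proj₂ c~s e)) w

  hasCycle⇒path : HasCycle H → ∃₂ λ a b → ∃₂ λ c d →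
    edge H a b ≡ true × edge H b c ≡ true × edge H c d ≡ true × a ≢ c × b ≢ d
  hasCycle⇒path (_ , []         , ()         , _)
  hasCycle⇒path (_ , _ ∷ []     , s≤s ()     , _)
  hasCycle⇒path (v , v₁ ∷ v₂ ∷ rest , _ , ((v≢v₁ ∷ v≢v₂ ∷ _) ∷ (_ ∷ v₁∉rest) ∷ _) , e₀ , e₁ , chain)
    = let d , e₂ , v₁≢d = next rest v₁∉rest chain in v , v₁ , v₂ , d , e₀ , e₁ , e₂ , v≢v₂ , v₁≢d
    where
    next : ∀ rest → All (v₁ ≢_) rest → Chain H (v₂ ∷ (rest ∷ʳ v)) → ∃ λ d → edge H v₂ d ≡ true × v₁ ≢ d
    next []      _          (e , _) = v , e , λ v₁≡v → v≢v₁ (sym v₁≡v)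
    next (r ∷ _) (v₁≢r ∷ _) (e , _) = r , e , v₁≢r

  -- a leaf of a pendant S-Steiner tree cannot hang on another leaf, as S has a third vertex to reach
  pendantTree-leaf-neighbour-∉ : ∀ {S s c} → IsPendantSteinerTree H S → 2 < ∣ S ∣ → s ∈ S →
    edge H s c ≡ true → c ∉ S
  pendantTree-leaf-neighbour-∉ {S} {s} {c} ((connected , _) , S⊆V , deg≡1) 2<∣S∣ s∈S s~c c∈S
    with t , t∈S , t≢s , t≢c ← ∈-avoiding₂ 2<∣S∣ s c =
    [ t≢s , t≢c ]′
      (walk-from-pendant-edge s-only-c c-only-s (inj₁ refl) (connected s t (S⊆V s∈S) (S⊆V t∈S)))
    where
    s-only-c : OnlyNeighbour s c
    s-only-c = degree≡1⇒onlyNeighbour (deg≡1 s s∈S) s~c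
    c-only-s : OnlyNeighbour c s
    c-only-s = degree≡1⇒onlyNeighbour (deg≡1 c c∈S) (trans (edge-sym H c s) s~c)

  pendantTree-∁⁅x⁆⇒edge-to-x : ∀ {x s} → IsPendantSteinerTree H (∁ ⁅ x ⁆) → 2 < ∣ ∁ ⁅ x ⁆ ∣ →
    s ∈ ∁ ⁅ x ⁆ → edge H s x ≡ true
  pendantTree-∁⁅x⁆⇒edge-to-x {x} {s} tree 2<∣S∣ s∈S =
    let c , s~c = degree≡1⇒neighbour (proj₂ (proj₂ tree) s s∈S)
    in  subst (λ c → edge H s c ≡ true) (≡x s~c) s~c
    where
    ≡x : ∀ {c} → edge H s c ≡ true → c ≡ x
    ≡x s~c = x∈⁅y⁆⇒x≡y x (x∉∁p⇒x∈p (pendantTree-leaf-neighbour-∉ tree 2<∣S∣ s∈S s~c))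

starEdge : Fin n → Fin n → Fin n → Bool
starEdge x u w = does (u ≟ x) xor does (w ≟ x)

module _ (x : Fin n) where

  starEdge-sym : ∀ u w → starEdge x u w ≡ starEdge x w u
  starEdge-sym u w with does (u ≟ x) | does (w ≟ x)
  ... | true  | true  = refl
  ... | true  | false = refl
  ... | false | true  = refl
  ... | false | false = refl

  starEdge-meets : ∀ u w → starEdge x u w ≡ true → u ≡ x ⊎ w ≡ x
  starEdge-meets u w e with u ≟ x | w ≟ x
  ... | yes u≡x | _       = inj₁ u≡x
  ... | no _    | yes w≡x = inj₂ w≡x
  starEdge-meets u w () | no _ | no _

  starEdge-≢ : ∀ u w → starEdge x u w ≡ true → u ≢ w
  starEdge-≢ u _ e refl with () ← trans (sym (xor-same (does (u ≟ x)))) e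

  starEdge-to-centre : ∀ {u} → u ≢ x → starEdge x u x ≡ true
  starEdge-to-centre {u} u≢x rewrite dec-false (u ≟ x) u≢x | dec-true (x ≟ x) refl = refl

  starEdge-centre : ∀ a b c → starEdge x a b ≡ true → starEdge x b c ≡ true → a ≢ c → b ≡ x
  starEdge-centre a b c ab bc a≢c with starEdge-meets a b ab | starEdge-meets b c bc
  ... | inj₂ b≡x | _        = b≡x
  ... | inj₁ _   | inj₁ b≡x = b≡x
  ... | inj₁ a≡x | inj₂ c≡x = contradiction (trans a≡x (sym c≡x)) a≢c

module _ {G : Graph n} (complete : Complete G) (x : Fin n) where

  star : Subgraph G
  star = record
    { vert      = ⊤
    ; edge      = starEdge x
    ; edge-sym  = starEdge-sym x
    ; edge-adj  = λ u w e → complete u w (starEdge-≢ x u w e)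
    ; edge-vert = λ _ _ _ → ∈⊤
    }

  star-connected : Connected star
  star-connected u w _ _ = to-centre u ◅◅ from-centre w
    where
    to-centre : ∀ u → Walk star u x
    to-centre u with u ≟ x
    ... | yes refl = here
    ... | no u≢x   = step (starEdge-to-centre x u≢x) here
    from-centre : ∀ w → Walk star x w
    from-centre w with w ≟ x
    ... | yes refl = here
    ... | no w≢x   = step (trans (starEdge-sym x x w) (starEdge-to-centre x w≢x)) here

  -- on a path a b c d the two middle edges force both b and c to be the centre
  star-acyclic : Acyclic star
  star-acyclic cycle with a , b , c , d , ab , bc , cd , a≢c , b≢d ← hasCycle⇒path star cycle =
    starEdge-≢ x b c bc
      (trans (starEdge-centre x a b c ab bc a≢c) (sym (starEdge-centre x b c d bc cd b≢d)))

  star-isPendantSteinerTree : ∀ {S} → x ∉ S → IsPendantSteinerTree star S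
  star-isPendantSteinerTree x∉S = (star-connected , star-acyclic) , (λ _ → ∈⊤) , leaf-degree
    where
    leaf-degree : ∀ s → s ∈ _ → degree star s ≡ 1
    leaf-degree s s∈S = onlyNeighbour⇒degree≡1 star {s} (starEdge-to-centre x s≢x , only)
      where
      s≢x : s ≢ x
      s≢x refl = x∉S s∈S
      only : ∀ {u} → starEdge x s u ≡ true → u ≡ x
      only e = [ (λ s≡x → contradiction s≡x s≢x) , id ]′ (starEdge-meets x s _ e)

  star-packing : ∀ {S} → x ∉ S → Packing G S 1
  star-packing x∉S = star ∷ [] , (λ { zero → star-isPendantSteinerTree x∉S }) ,
    λ { zero zero 0≢0 → contradiction refl 0≢0 }

module _ {G : Graph n} (x : Fin n) (2<∣S∣ : 2 < ∣ ∁ ⁅ x ⁆ ∣) where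

  -- any two pendant trees for V ∖ {x} share the edge s x
  packing-∁⁅x⁆-≤1 : ∀ {k} → Packing G (∁ ⁅ x ⁆) k → k ≤ 1
  packing-∁⁅x⁆-≤1 ([]          , _)              = z≤n
  packing-∁⁅x⁆-≤1 (_ ∷ []      , _)              = s≤s z≤n
  packing-∁⁅x⁆-≤1 (T₀ ∷ T₁ ∷ _ , trees , disjoint)
    with s , s∈S ← 0<∣p∣⇒nonempty (≤-trans (s≤s z≤n) 2<∣S∣)
    with () ← trans
      (sym (disjoint zero (suc zero) (λ ()) s x
        (pendantTree-∁⁅x⁆⇒edge-to-x T₀ (trees zero) 2<∣S∣ s∈S)))
      (pendantTree-∁⁅x⁆⇒edge-to-x T₁ (trees (suc zero)) 2<∣S∣ s∈S)

  packing-∁⁅x⁆-≡0 : ∀ {s k} → s ∈ ∁ ⁅ x ⁆ → adj G s x ≡ false → Packing G (∁ ⁅ x ⁆) k → k ≡ 0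
  packing-∁⁅x⁆-≡0 _   _   ([]    , _)         = refl
  packing-∁⁅x⁆-≡0 s∈S s≁x (T ∷ _ , trees , _)
    with () ← trans (sym s≁x) (edge-adj T _ x (pendantTree-∁⁅x⁆⇒edge-to-x T (trees zero) 2<∣S∣ s∈S))

  μ-∁⁅x⁆≡1 : Complete G → IsMuS G (∁ ⁅ x ⁆) 1
  μ-∁⁅x⁆≡1 complete = star-packing complete x x∉∁⁅x⁆ , λ _ → packing-∁⁅x⁆-≤1
    where
    x∉∁⁅x⁆ : x ∉ ∁ ⁅ x ⁆
    x∉∁⁅x⁆ x∈ = Equivalence.to x∈∁⁅y⁆⇔x≢y x∈ refl

  μ-∁⁅x⁆≡0 : ∀ {s} → s ∈ ∁ ⁅ x ⁆ → adj G s x ≡ false → IsMuS G (∁ ⁅ x ⁆) 0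
  μ-∁⁅x⁆≡0 s∈S s≁x = ([] , (λ ()) , λ ()) , λ _ P → ≤-reflexive (packing-∁⁅x⁆-≡0 s∈S s≁x P)

IsMuK-functional : ∀ {G : Graph n} {k a b} → IsMuK G k a → IsMuK G k b → a ≡ b
IsMuK-functional ((S , ∣S∣≡k , μS≡a) , a-min) ((T , ∣T∣≡k , μT≡b) , b-min) =
  ≤-antisym (a-min T ∣T∣≡k _ μT≡b) (b-min S ∣S∣≡k _ μS≡a)

complete⊎nonadjacent : (G : Graph n) → Complete G ⊎ ∃₂ λ u v → u ≢ v × adj G u v ≡ false
complete⊎nonadjacent G with any? (λ u → any? (λ v → ¬? (u ≟ v) ×-dec (adj G u v Bool.≟ false)))
... | yes (u , v , nonadjacent) = inj₂ (u , v , nonadjacent)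
... | no  ∄nonadjacent          = inj₁ λ u v u≢v → ¬-not λ u≁v → ∄nonadjacent (u , v , u≢v , u≁v)

module _ {m} {G : Graph (suc m)} (2<m : 2 < m) where

  2<∣∁⁅x⁆∣ : ∀ x → 2 < ∣ ∁ ⁅ x ⁆ ∣
  2<∣∁⁅x⁆∣ x = subst (2 <_) (sym (∣∁⁅x⁆∣≡m x)) 2<m

  μₙ₋₁≡1 : Complete G → IsMuK G m 1
  μₙ₋₁≡1 complete = (∁ ⁅ zero ⁆ , ∣∁⁅x⁆∣≡m zero , μ-∁⁅x⁆≡1 zero (2<∣∁⁅x⁆∣ zero) complete) , minimal
    where
    minimal : ∀ S → ∣ S ∣ ≡ m → ∀ k → IsMuS G S k → 1 ≤ k
    minimal S ∣S∣≡m k (_ , maximal) with x , refl ← ∣p∣≡m⇒p≡∁⁅x⁆ {p = S} ∣S∣≡m =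
      maximal 1 (proj₁ (μ-∁⁅x⁆≡1 x (2<∣∁⁅x⁆∣ x) complete))

  μₙ₋₁≡0 : ∀ {u v} → u ≢ v → adj G u v ≡ false → IsMuK G m 0
  μₙ₋₁≡0 {v = v} u≢v u≁v =
    (∁ ⁅ v ⁆ , ∣∁⁅x⁆∣≡m v , μ-∁⁅x⁆≡0 v (2<∣∁⁅x⁆∣ v) (Equivalence.from x∈∁⁅y⁆⇔x≢y u≢v) u≁v) ,
    λ _ _ _ _ → z≤n

corollary2p2 : ∀ (n : ℕ) → 4 ≤ n → (G : Graph n) →
    (IsMuK G (n ∸ 1) 1 ⇔ Complete G) × (IsMuK G (n ∸ 1) 0 ⇔ (¬ Complete G))
corollary2p2 (suc m) (s≤s 2<m) G =
  mk⇔ μ≡1⇒complete (μₙ₋₁≡1 2<m) , mk⇔ μ≡0⇒incomplete incomplete⇒μ≡0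
  where
  μ≡1⇒complete : IsMuK G m 1 → Complete G
  μ≡1⇒complete μ≡1 with complete⊎nonadjacent G
  ... | inj₁ complete            = complete
  ... | inj₂ (_ , _ , u≢v , u≁v) with () ← IsMuK-functional μ≡1 (μₙ₋₁≡0 2<m u≢v u≁v)

  μ≡0⇒incomplete : IsMuK G m 0 → ¬ Complete G
  μ≡0⇒incomplete μ≡0 complete with () ← IsMuK-functional μ≡0 (μₙ₋₁≡1 2<m complete)

  incomplete⇒μ≡0 : ¬ Complete G → IsMuK G m 0
  incomplete⇒μ≡0 incomplete with complete⊎nonadjacent G
  ... | inj₁ complete            = contradiction complete incomplete
  ... | inj₂ (_ , _ , u≢v , u≁v) = μₙ₋₁≡0 2<m u≢v u≁v
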